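{- Assume the weak form of Szpiro's conjecture. Let $s>0$ be a fixed positive integer and let $$f(x,y)=x^{2s}y^s\pm y^{2s}x^s$$ (for a fixed choice of sign). Let $p_1<\dots<p_q$ be fixed primes, let $b$ be a fixed non-zero integer, and let $l\geq1$ and $A_1,\dots,A_l$ be fixed positive integers. Assume $f(x,y)$ has at least three pairwise non-proportional linear factors over $\mathbb{C}$. Then the equation $$b\,p_1^{z_1}\cdots p_q^{z_q}\cdot n_1!A_1^{n_1}\cdots n_l!A_l^{n_l}=f(x,y)$$ has only finitely many integer solutions $(z_1,\dots,z_q,n_1,\dots,n_l,x,y)$ with all $z_i\geq 0$, all $n_j>0$, and $\gcd(x,y)=1$.
   Context: For a non-zero integer $a$, the radical is $N(a)=\prod_{p\mid a}p$ (product over the distinct primes dividing $a$). The weak form of Szpiro's conjecture is the statement: there exists a constant $s'>0$ such that for all pairwise coprime integers $A,B,C$ with $A+B=C$ one has $|ABC|<N(ABC)^{s'}$. -}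

module Defs where

open import Data.Bool using (if_then_else_; _∧_)
open import Data.Nat as ℕ using (ℕ; suc; _!; _^_)
open import Data.Nat.Primality using (prime?)
open import Data.Nat.Divisibility using (_∣?_)
open import Data.Nat.Coprimality using (Coprime)
open import Data.Integer as ℤ using (ℤ; +_; ∣_∣)
open import Data.List using (List; map; upTo)
open import Data.Nat.ListAction using (product)
open import Data.Vec using (Vec; zipWith; toList)
open import Data.Sign using (Sign)
open import Data.Product using (∃; _×_)
open import Relation.Nullary using (¬_)
open import Relation.Nullary.Decidable using (⌊_⌋)
open import Relation.Binary.PropositionalEquality using (_≡_)

-- Radical of a natural number: product of the distinct primes dividing it
-- (all such primes are ≤ n when n ≠ 0).
radℕ : ℕ → ℕ
radℕ n = product (map (λ p → if ⌊ prime? p ⌋ ∧ ⌊ p ∣? n ⌋ then p else 1) (upTo (suc n)))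

-- N(a) for an integer a (meaningful for a ≠ 0).
N : ℤ → ℕ
N a = radℕ ∣ a ∣

-- Weak form of Szpiro's conjecture. The exponent s' is taken in ℕ
-- (equivalent to a real s' > 0 since N(ABC) ≥ 1).
WeakSzpiro : Set
WeakSzpiro = ∃ λ (s' : ℕ) → (0 ℕ.< s') ×
  ((A B C : ℤ) → Coprime ∣ A ∣ ∣ B ∣ → Coprime ∣ A ∣ ∣ C ∣ → Coprime ∣ B ∣ ∣ C ∣ →
   A ℤ.+ B ≡ C → ¬ (A ℤ.* B ℤ.* C ≡ + 0) →
   ∣ A ℤ.* B ℤ.* C ∣ ℕ.< N (A ℤ.* B ℤ.* C) ^ s')

f : Sign → ℕ → ℤ → ℤ → ℤ
f Sign.+ s x y = (x ℤ.^ (2 ℕ.* s)) ℤ.* (y ℤ.^ s) ℤ.+ (y ℤ.^ (2 ℕ.* s)) ℤ.* (x ℤ.^ s)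
f Sign.- s x y = (x ℤ.^ (2 ℕ.* s)) ℤ.* (y ℤ.^ s) ℤ.- (y ℤ.^ (2 ℕ.* s)) ℤ.* (x ℤ.^ s)

primePart : ∀ {q} → Vec ℕ q → Vec ℕ q → ℕ
primePart p z = product (toList (zipWith _^_ p z))

factPart : ∀ {l} → Vec ℕ l → Vec ℕ l → ℕ
factPart A n = product (toList (zipWith (λ a m → (m !) ℕ.* (a ^ m)) A n))

-- With X = x^s and Y = ±y^s one has f(x, y) = ±XY(X + Y), and for coprime x, y the triple
-- (X, Y, X + Y) is pairwise coprime, so weak Szpiro gives |f| < rad(f)^e.  For a solution,
-- every prime dividing f divides b, some p_i or some A_j, or is at most M = max n_j.  Chebyshev's
-- bound ∏_{p<n} p ≤ 8^n (the primes in (b, a + b] divide (a + b choose a) ≤ 2^(a+b)) then gives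
-- rad(f) ≤ c 8^M for a constant c.  As M! ≤ |f| as well, M! is bounded by an exponential in M,
-- so M is bounded, hence |f| is, and every coordinate of a solution is at most |f|.

module Submission where

open import Data.Bool.Base using (if_then_else_; _∧_)
open import Data.Empty using (⊥-elim)
open import Data.Fin.Base as Fin using (Fin)
open import Data.Integer.Base as ℤ using (ℤ; +_; -[1+_])
import Data.Integer.Properties as ℤ
open import Data.Integer.Divisibility.Signed as ℤ∣ using (∣ᵤ⇒∣; ∣⇒∣ᵤ)
open import Data.Integer.GCD using (gcd)
import Data.Integer.Tactic.RingSolver as ℤ-Solver
open import Data.List.Base as List using (List; [_]; _++_; _∷ʳ_; upTo; cartesianProduct; cartesianProductWith)
open import Data.List.Properties using (upTo-∷ʳ; map-++)
open import Data.List.Membership.Propositional using (_∈_)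
open import Data.List.Membership.Propositional.Properties
  using (∈-map⁺; ∈-upTo⁺; ∈-++⁺ˡ; ∈-++⁺ʳ; ∈-cartesianProduct⁺; ∈-cartesianProductWith⁺)
open import Data.List.Relation.Unary.Any using (here)
open import Data.Nat.Base
open import Data.Nat.Combinatorics using (_C_; nCk+nC[k+1]≡[n+1]C[k+1]; k![n∸k]!∣n!)
open import Data.Nat.Combinatorics.Specification using (nCk≡n!/k![n-k]!)
open import Data.Nat.Coprimality as Coprime using (Coprime; coprime-divisor; gcd≡1⇒coprime)
open import Data.Nat.Divisibility
open import Data.Nat.DivMod using (m/n*n≡m)
open import Data.Nat.Induction using (<-rec)
open import Data.Nat.ListAction using (product)
open import Data.Nat.ListAction.Properties using (product-++; ∈⇒∣product)
open import Data.Nat.Primality using (Prime; prime?; ¬prime[1]; euclidsLemma; prime⇒nonZero; prime⇒nonTrivial)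
open import Data.Nat.Properties
open import Algebra.Properties.CommutativeSemigroup *-commutativeSemigroup using (x∙yz≈y∙xz; x∙yz≈yx∙z)
open import Data.Nat.Tactic.RingSolver using (solve-∀)
open import Data.Product using (∃; ∃-syntax; _×_; _,_; proj₁; proj₂)
open import Data.Sign.Base using (Sign)
open import Data.Sum as Sum using (_⊎_; inj₁; inj₂)
open import Data.Vec.Base using (Vec; []; _∷_; lookup; toList)
open import Defs
open import Function using (_∘_)
open import Relation.Binary.PropositionalEquality
  using (_≡_; refl; sym; trans; cong; cong₂; subst; subst₂; module ≡-Reasoning)
open import Relation.Nullary using (¬_; yes; no)
open import Relation.Nullary.Decidable using (⌊_⌋)

private variable
  a b k l m n p q r : ℕ
  i j : ℤ

prime∤1 : Prime p → ¬ p ∣ 1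
prime∤1 p-prime p∣1 = ¬prime[1] (subst Prime (∣1⇒≡1 p∣1) p-prime)

prime∣^⇒∣ : Prime p → p ∣ m ^ k → p ∣ m
prime∣^⇒∣ {k = zero}      p-prime p∣1 = ⊥-elim (prime∤1 p-prime p∣1)
prime∣^⇒∣ {m = m} {suc k} p-prime p∣m^k+1 with euclidsLemma m (m ^ k) p-prime p∣m^k+1
... | inj₁ p∣m   = p∣m
... | inj₂ p∣m^k = prime∣^⇒∣ {k = k} p-prime p∣m^k

prime∣n!⇒≤ : Prime p → p ∣ n ! → p ≤ n
prime∣n!⇒≤ {n = zero}  p-prime p∣1 = ⊥-elim (prime∤1 p-prime p∣1)
prime∣n!⇒≤ {n = suc n} p-prime p∣n+1! with euclidsLemma (suc n) (n !) p-prime p∣n+1!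
... | inj₁ p∣n+1 = ∣⇒≤ p∣n+1
... | inj₂ p∣n!  = m≤n⇒m≤1+n (prime∣n!⇒≤ p-prime p∣n!)

m∣n! : .{{NonZero m}} → m ≤ n → m ∣ n !
m∣n! {suc m} m≤n = ∣-trans (m∣m*n (m !)) (m≤n⇒m!∣n! m≤n)

m∣k∧p∣k⇒m*p∣k : Prime p → ¬ p ∣ m → m ∣ k → p ∣ k → m * p ∣ k
m∣k∧p∣k⇒m*p∣k {p} {m} p-prime p∤m (divides t refl) p∣t*m with euclidsLemma t m p-prime p∣t*m
... | inj₁ p∣t = subst (m * p ∣_) (*-comm m t) (*-monoʳ-∣ m p∣t)
... | inj₂ p∣m = ⊥-elim (p∤m p∣m)

PrimeSelector : (ℕ → ℕ) → Set
PrimeSelector g = ∀ j → g j ≡ 1 ⊎ (Prime j × g j ≡ j)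

productUpTo : (ℕ → ℕ) → ℕ → ℕ
productUpTo g n = product (List.map g (upTo n))

productUpTo-suc : ∀ g n → productUpTo g (suc n) ≡ productUpTo g n * g n
productUpTo-suc g n = begin
  product (List.map g (upTo (suc n)))       ≡⟨ cong (product ∘ List.map g) (upTo-∷ʳ n) ⟨
  product (List.map g (upTo n ∷ʳ n))        ≡⟨ cong product (map-++ g (upTo n) [ n ]) ⟩
  product (List.map g (upTo n) ++ [ g n ])  ≡⟨ product-++ (List.map g (upTo n)) [ g n ] ⟩
  productUpTo g n * (g n * 1)               ≡⟨ cong (productUpTo g n *_) (*-identityʳ (g n)) ⟩
  productUpTo g n * g n                     ∎
  where open ≡-Reasoning

module _ {g : ℕ → ℕ} (g-selects : PrimeSelector g) where

  prime∣productUpTo⇒< : Prime p → p ∣ productUpTo g n → p < n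
  prime∣productUpTo⇒< {n = zero} p-prime p∣1 = ⊥-elim (prime∤1 p-prime p∣1)
  prime∣productUpTo⇒< {p} {suc n} p-prime p∣∏
    with euclidsLemma _ (g n) p-prime (subst (p ∣_) (productUpTo-suc g n) p∣∏)
  ... | inj₁ p∣∏′ = m<n⇒m<1+n (prime∣productUpTo⇒< p-prime p∣∏′)
  ... | inj₂ p∣gn with g-selects n
  ...   | inj₁ gn≡1            = ⊥-elim (prime∤1 p-prime (subst (p ∣_) gn≡1 p∣gn))
  ...   | inj₂ (n-prime , gn≡n) = s≤s (∣⇒≤ {{prime⇒nonZero n-prime}} (subst (p ∣_) gn≡n p∣gn))

  productUpTo>0 : ∀ n → 0 < productUpTo g n
  productUpTo>0 zero    = z<s
  productUpTo>0 (suc n) =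
    subst (0 <_) (sym (productUpTo-suc g n)) (*-mono-≤ (productUpTo>0 n) (selected>0 (g-selects n)))
    where
    selected>0 : g n ≡ 1 ⊎ (Prime n × g n ≡ n) → 0 < g n
    selected>0 (inj₁ gn≡1)            = subst (0 <_) (sym gn≡1) z<s
    selected>0 (inj₂ (n-prime , gn≡n)) = subst (0 <_) (sym gn≡n) (>-nonZero⁻¹ n {{prime⇒nonZero n-prime}})

  productUpTo-∣ : (∀ j → j < n → Prime j → g j ≡ j → j ∣ k) → productUpTo g n ∣ k
  productUpTo-∣ {zero}  {k} _ = 1∣ k
  productUpTo-∣ {suc n} {k} selected∣k =
    subst (_∣ k) (sym (productUpTo-suc g n)) (extend (g-selects n))
    where
    ∏∣k : productUpTo g n ∣ k
    ∏∣k = productUpTo-∣ (λ j j<n → selected∣k j (m<n⇒m<1+n j<n))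

    extend : g n ≡ 1 ⊎ (Prime n × g n ≡ n) → productUpTo g n * g n ∣ k
    extend (inj₁ gn≡1) rewrite gn≡1 = subst (_∣ k) (sym (*-identityʳ _)) ∏∣k
    extend (inj₂ (n-prime , gn≡n)) rewrite gn≡n =
      m∣k∧p∣k⇒m*p∣k n-prime n∤∏ ∏∣k (selected∣k n ≤-refl n-prime gn≡n)
      where
      n∤∏ : ¬ n ∣ productUpTo g n
      n∤∏ n∣∏ = <-irrefl refl (prime∣productUpTo⇒< n-prime n∣∏)

radicalFactor : ℕ → ℕ → ℕ
radicalFactor m p = if ⌊ prime? p ⌋ ∧ ⌊ p ∣? m ⌋ then p else 1

radicalFactor-selects : ∀ m → PrimeSelector (radicalFactor m)
radicalFactor-selects m j with prime? j | j ∣? m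
... | yes j-prime | yes _ = inj₂ (j-prime , refl)
... | yes _       | no _  = inj₁ refl
... | no _        | _     = inj₁ refl

radicalFactor≡⇒∣ : Prime p → radicalFactor m p ≡ p → p ∣ m
radicalFactor≡⇒∣ {p} {m} p-prime selected with prime? p | p ∣? m
... | yes _     | yes p∣m = p∣m
... | yes _     | no _    = ⊥-elim (¬prime[1] (subst Prime (sym selected) p-prime))
... | no ¬prime | _       = ⊥-elim (¬prime p-prime)

-- radℕ m unfolds to productUpTo (radicalFactor m) (suc m).
radℕ-∣ : (∀ p → Prime p → p ∣ m → p ∣ k) → radℕ m ∣ k
radℕ-∣ {m} prime∣k = productUpTo-∣ (radicalFactor-selects m) {suc m}
  (λ p _ p-prime selected → prime∣k p p-prime (radicalFactor≡⇒∣ p-prime selected))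

primeOrOne : ℕ → ℕ
primeOrOne p = if ⌊ prime? p ⌋ then p else 1

primeOrOne-selects : PrimeSelector primeOrOne
primeOrOne-selects p with prime? p
... | yes p-prime = inj₂ (p-prime , refl)
... | no _        = inj₁ refl

-- The product of the primes p < n (not p ≤ n).
primorial : ℕ → ℕ
primorial = productUpTo primeOrOne

prime∣primorial : Prime p → p < n → p ∣ primorial n
prime∣primorial {p} {n} p-prime p<n =
  subst (_∣ primorial n) primeOrOne-p≡p (∈⇒∣product (∈-map⁺ primeOrOne (∈-upTo⁺ p<n)))
  where
  primeOrOne-p≡p : primeOrOne p ≡ p
  primeOrOne-p≡p with prime? p
  ... | yes _     = refl
  ... | no ¬prime = ⊥-elim (¬prime p-prime)

primorial>0 : ∀ n → 0 < primorial n
primorial>0 = productUpTo>0 primeOrOne-selects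

primorial-∣ : (∀ p → p < n → Prime p → p ∣ k) → primorial n ∣ k
primorial-∣ prime∣k = productUpTo-∣ primeOrOne-selects (λ p p<n p-prime _ → prime∣k p p<n p-prime)

-- Chebyshev's bound on the primorial

nCk*[k!*[n∸k]!]≡n! : k ≤ n → (n C k) * (k ! * (n ∸ k) !) ≡ n !
nCk*[k!*[n∸k]!]≡n! {k} {n} k≤n = begin
  (n C k) * d              ≡⟨ cong (_* d) (nCk≡n!/k![n-k]! k≤n) ⟩
  (n ! / d) {{d≢0}} * d    ≡⟨ m/n*n≡m {{d≢0}} (k![n∸k]!∣n! k≤n) ⟩
  n !                      ∎
  where
  open ≡-Reasoning
  d = k ! * (n ∸ k) !
  d≢0 = k !* (n ∸ k) !≢0

nCk>0 : k ≤ n → 0 < n C k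
nCk>0 {k} {n} k≤n = n≢0⇒n>0 λ nCk≡0 →
  <-irrefl refl (subst (0 <_) (trans (sym (nCk*[k!*[n∸k]!]≡n! k≤n)) (cong (_* (k ! * (n ∸ k) !)) nCk≡0)) (1≤n! n))

nCk≤2^n : ∀ n k → n C k ≤ 2 ^ n
nCk≤2^n n       zero    = m^n>0 2 n
nCk≤2^n zero    (suc k) = z≤n
nCk≤2^n (suc n) (suc k) = begin
  suc n C suc k      ≡⟨ nCk+nC[k+1]≡[n+1]C[k+1] n k ⟨
  n C k + n C suc k  ≤⟨ +-mono-≤ (nCk≤2^n n k) (nCk≤2^n n (suc k)) ⟩
  2 ^ n + 2 ^ n      ≡⟨ cong (_+_ (2 ^ n)) (+-identityʳ (2 ^ n)) ⟨
  2 ^ suc n          ∎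
  where open ≤-Reasoning

prime∣nCk : Prime p → k < p → n ∸ k < p → p ≤ n → p ∣ n C k
prime∣nCk {p} {k} {n} p-prime k<p n∸k<p p≤n
  with euclidsLemma (n C k) (k ! * (n ∸ k) !) p-prime p∣n!
  where
  p∣n! : p ∣ (n C k) * (k ! * (n ∸ k) !)
  p∣n! = subst (p ∣_) (sym (nCk*[k!*[n∸k]!]≡n! (<⇒≤ (<-≤-trans k<p p≤n)))) (m∣n! {{prime⇒nonZero p-prime}} p≤n)
... | inj₁ p∣nCk = p∣nCk
... | inj₂ p∣k!*[n∸k]! with euclidsLemma (k !) ((n ∸ k) !) p-prime p∣k!*[n∸k]!
...   | inj₁ p∣k!     = ⊥-elim (<⇒≱ k<p (prime∣n!⇒≤ p-prime p∣k!))
...   | inj₂ p∣[n∸k]! = ⊥-elim (<⇒≱ n∸k<p (prime∣n!⇒≤ p-prime p∣[n∸k]!))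

primorial-double : a ≤ b → primorial (suc b + a) ≤ primorial (suc b) * 2 ^ (a + b)
primorial-double {a} {b} a≤b = begin
  primorial (suc b + a)                ≤⟨ ∣⇒≤ {{m*n≢0 _ _ {{∏≢0}} {{nCk≢0}}}} (primorial-∣ prime∣bound) ⟩
  primorial (suc b) * ((a + b) C a)    ≤⟨ *-monoʳ-≤ (primorial (suc b)) (nCk≤2^n (a + b) a) ⟩
  primorial (suc b) * 2 ^ (a + b)      ∎
  where
  open ≤-Reasoning
  ∏≢0 = >-nonZero (primorial>0 (suc b))
  nCk≢0 = >-nonZero (nCk>0 (m≤m+n a b))

  prime∣bound : ∀ p → p < suc b + a → Prime p → p ∣ primorial (suc b) * ((a + b) C a)
  prime∣bound p p<1+b+a p-prime with p ≤? b
  ... | yes p≤b = ∣m⇒∣m*n _ (prime∣primorial p-prime (s≤s p≤b))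
  ... | no p≰b  = ∣n⇒∣m*n (primorial (suc b))
    (prime∣nCk p-prime (≤-<-trans a≤b b<p) (subst (_< p) (sym (m+n∸m≡n a b)) b<p) p≤a+b)
    where
    b<p : b < p
    b<p = ≰⇒> p≰b
    p≤a+b : p ≤ a + b
    p≤a+b = subst (p ≤_) (+-comm b a) (≤-pred p<1+b+a)

primorial-step : 0 < a → a ≤ b → b ≤ suc a →
                 primorial (suc b) ≤ 8 ^ suc b → primorial (suc (a + b)) ≤ 8 ^ suc (a + b)
primorial-step {a} {b} a>0 a≤b b≤1+a primorial≤ = begin
  primorial (suc (a + b))          ≡⟨ cong (primorial ∘ suc) (+-comm a b) ⟩
  primorial (suc b + a)            ≤⟨ primorial-double a≤b ⟩
  primorial (suc b) * 2 ^ (a + b)  ≤⟨ *-monoˡ-≤ (2 ^ (a + b)) primorial≤ ⟩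
  8 ^ suc b * 2 ^ (a + b)          ≡⟨ cong (_* 2 ^ (a + b)) (^-*-assoc 2 3 (suc b)) ⟩
  2 ^ (3 * suc b) * 2 ^ (a + b)    ≡⟨ ^-distribˡ-+-* 2 (3 * suc b) (a + b) ⟨
  2 ^ (3 * suc b + (a + b))        ≤⟨ ^-monoʳ-≤ 2 exponent≤ ⟩
  2 ^ (3 * suc (a + b))            ≡⟨ ^-*-assoc 2 3 (suc (a + b)) ⟨
  8 ^ suc (a + b)                  ∎
  where
  open ≤-Reasoning
  exponent≤ : 3 * suc b + (a + b) ≤ 3 * suc (a + b)
  exponent≤ = begin
    3 * suc b + (a + b)        ≡⟨ regroup₁ a b ⟩
    (3 + a + 3 * b) + b        ≤⟨ +-monoʳ-≤ (3 + a + 3 * b) (≤-trans b≤1+a (+-monoˡ-≤ a a>0)) ⟩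
    (3 + a + 3 * b) + (a + a)  ≡⟨ regroup₂ a b ⟩
    3 * suc (a + b)            ∎
    where
    regroup₁ : ∀ a b → 3 * suc b + (a + b) ≡ (3 + a + 3 * b) + b
    regroup₁ = solve-∀
    regroup₂ : ∀ a b → (3 + a + 3 * b) + (a + a) ≡ 3 * suc (a + b)
    regroup₂ = solve-∀

primorial≤8^n : ∀ n → primorial n ≤ 8 ^ n
primorial≤8^n = <-rec _ bound
  where
  bound : ∀ n → (∀ {m} → m < n → primorial m ≤ 8 ^ m) → primorial n ≤ 8 ^ n
  bound 0 _ = ≤-refl
  bound 1 _ = s≤s z≤n
  bound 2 _ = s≤s z≤n
  bound (suc n@(suc (suc _))) smaller = subst (λ k → primorial (suc k) ≤ 8 ^ suc k) (⌊n/2⌋+⌈n/2⌉≡n n)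
    (primorial-step z<s (⌊n/2⌋≤⌈n/2⌉ n) (⌈n/2⌉-mono (n≤1+n n)) (smaller (s<s (⌈n/2⌉<n _))))

-- Factorials outgrow exponentials

^-distribʳ-* : ∀ m n o → (m * n) ^ o ≡ m ^ o * n ^ o
^-distribʳ-* m n zero    = refl
^-distribʳ-* m n (suc o) =
  trans (cong (m * n *_) (^-distribʳ-* m n o)) ([m*n]*[o*p]≡[m*o]*[n*p] m n (m ^ o) (n ^ o))

n<2^n : ∀ n → n < 2 ^ n
n<2^n zero    = z<s
n<2^n (suc n) = subst (suc (suc n) ≤_) (cong (_+_ (2 ^ n)) (sym (+-identityʳ (2 ^ n))))
  (+-mono-≤ (m^n>0 2 n) (n<2^n n))

m≤m^n : ∀ m n .{{_ : NonZero n}} → m ≤ m ^ n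
m≤m^n zero    (suc n) = z≤n
m≤m^n (suc m) (suc n) = m≤m*n (suc m) (suc m ^ n) {{m^n≢0 (suc m) n}}

n≤n! : ∀ n → n ≤ n !
n≤n! zero    = z≤n
n≤n! (suc n) = m≤m*n (suc n) (n !) {{n !≢0}}

[m⊔n]!≤m!*n! : ∀ m n → (m ⊔ n) ! ≤ m ! * n !
[m⊔n]!≤m!*n! m n with ≤-total m n
... | inj₁ m≤n = subst (λ k → k ! ≤ m ! * n !) (sym (m≤n⇒m⊔n≡n m≤n)) (m≤n*m (n !) (m !) {{m !≢0}})
... | inj₂ n≤m = subst (λ k → k ! ≤ m ! * n !) (sym (m≥n⇒m⊔n≡m n≤m)) (m≤m*n (m !) (n !) {{n !≢0}})

-- Below e the factor e of e ^ n is paid for by e ^ e, from e on by the factor of n !.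
e^n≤e^e*n! : ∀ e n → e ^ n ≤ e ^ e * n !
e^n≤e^e*n! e zero = ≤-trans (e^e>0 e) (m≤m*n (e ^ e) 1)
  where
  e^e>0 : ∀ e → 0 < e ^ e
  e^e>0 zero      = z<s
  e^e>0 e@(suc _) = m^n>0 e e
e^n≤e^e*n! e (suc n) with e ≤? suc n
... | yes e≤1+n = begin
  e * e ^ n                ≤⟨ *-mono-≤ e≤1+n (e^n≤e^e*n! e n) ⟩
  suc n * (e ^ e * n !)    ≡⟨ x∙yz≈y∙xz (suc n) (e ^ e) (n !) ⟩
  e ^ e * (suc n * n !)    ∎
  where open ≤-Reasoning
... | no e≰1+n = begin
  e ^ suc n        ≤⟨ ^-monoʳ-≤ e {{>-nonZero (m<n⇒0<n 1+n<e)}} (<⇒≤ 1+n<e) ⟩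
  e ^ e            ≤⟨ m≤m*n (e ^ e) (suc n !) {{suc n !≢0}} ⟩
  e ^ e * suc n !  ∎
  where
  open ≤-Reasoning
  1+n<e : suc n < e
  1+n<e = ≰⇒> e≰1+n

exponential<factorial : ∀ c d .{{_ : NonZero d}} → ∃[ n₀ ] ∀ n → n₀ ≤ n → c * d ^ n < n !
exponential<factorial c d = c * K , λ n c*K≤n → *-cancelˡ-< K (c * d ^ n) (n !) (begin-strict
  K * (c * d ^ n)  ≡⟨ x∙yz≈yx∙z K c (d ^ n) ⟩
  c * K * d ^ n    ≤⟨ *-monoˡ-≤ (d ^ n) c*K≤n ⟩
  n * d ^ n        <⟨ *-monoˡ-< (d ^ n) {{m^n≢0 d n}} (n<2^n n) ⟩
  2 ^ n * d ^ n    ≡⟨ ^-distribʳ-* 2 d n ⟨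
  (2 * d) ^ n      ≤⟨ e^n≤e^e*n! (2 * d) n ⟩
  K * n !          ∎)
  where
  open ≤-Reasoning
  K = (2 * d) ^ (2 * d)

[c*d^n]^e≡c^e*[d^e]^n : ∀ c d n e → (c * d ^ n) ^ e ≡ c ^ e * (d ^ e) ^ n
[c*d^n]^e≡c^e*[d^e]^n c d n e = begin
  (c * d ^ n) ^ e      ≡⟨ ^-distribʳ-* c (d ^ n) e ⟩
  c ^ e * (d ^ n) ^ e  ≡⟨ cong (c ^ e *_) (^-*-assoc d n e) ⟩
  c ^ e * d ^ (n * e)  ≡⟨ cong (λ k → c ^ e * d ^ k) (*-comm n e) ⟩
  c ^ e * d ^ (e * n)  ≡⟨ cong (c ^ e *_) (^-*-assoc d e n) ⟨
  c ^ e * (d ^ e) ^ n  ∎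
  where open ≡-Reasoning

factorial-bounded : ∀ c d e .{{_ : NonZero d}} →
                    ∃[ B ] ∀ n m → n ! ≤ m → m < (c * d ^ n) ^ e → m < B
factorial-bounded c d e with exponential<factorial (c ^ e) (d ^ e) {{m^n≢0 d e}}
... | n₀ , exponential<n! = (c * d ^ n₀) ^ e , bounded
  where
  bounded : ∀ n m → n ! ≤ m → m < (c * d ^ n) ^ e → m < (c * d ^ n₀) ^ e
  bounded n m n!≤m m<[c*d^n]^e with n <? n₀
  ... | yes n<n₀ = <-≤-trans m<[c*d^n]^e (^-monoˡ-≤ e (*-monoʳ-≤ c (^-monoʳ-≤ d (<⇒≤ n<n₀))))
  ... | no n≮n₀  = ⊥-elim (<-irrefl refl (≤-<-trans n!≤m (<-trans m<c^e*[d^e]^n (exponential<n! n (≮⇒≥ n≮n₀)))))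
    where
    m<c^e*[d^e]^n : m < c ^ e * (d ^ e) ^ n
    m<c^e*[d^e]^n = subst (m <_) ([c*d^n]^e≡c^e*[d^e]^n c d n e) m<[c*d^n]^e

product>0 : (v : Vec ℕ q) → (∀ i → 0 < lookup v i) → 0 < product (toList v)
product>0 []      _   = z<s
product>0 (x ∷ v) v>0 = *-mono-≤ (v>0 Fin.zero) (product>0 v (v>0 ∘ Fin.suc))

primePart>0 : (p z : Vec ℕ q) → (∀ i → 0 < lookup p i) → 0 < primePart p z
primePart>0 []       []       _   = z<s
primePart>0 (pᵢ ∷ p) (zᵢ ∷ z) p>0 =
  *-mono-≤ (m^n>0 pᵢ {{>-nonZero (p>0 Fin.zero)}} zᵢ) (primePart>0 p z (p>0 ∘ Fin.suc))

lookup≤primePart : (p z : Vec ℕ q) → (∀ i → 1 < lookup p i) → ∀ i → lookup z i ≤ primePart p z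
lookup≤primePart (pᵢ ∷ p) (zᵢ ∷ z) p>1 Fin.zero = begin
  zᵢ                       ≤⟨ <⇒≤ (n<2^n zᵢ) ⟩
  2 ^ zᵢ                   ≤⟨ ^-monoˡ-≤ zᵢ (p>1 Fin.zero) ⟩
  pᵢ ^ zᵢ                  ≤⟨ m≤m*n (pᵢ ^ zᵢ) (primePart p z) {{>-nonZero (primePart>0 p z (m<n⇒0<n ∘ p>1 ∘ Fin.suc))}} ⟩
  pᵢ ^ zᵢ * primePart p z  ∎
  where open ≤-Reasoning
lookup≤primePart (pᵢ ∷ p) (zᵢ ∷ z) p>1 (Fin.suc i) =
  ≤-trans (lookup≤primePart p z (p>1 ∘ Fin.suc) i) (m≤n*m (primePart p z) (pᵢ ^ zᵢ) {{m^n≢0 pᵢ zᵢ {{pᵢ≢0}}}})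
  where pᵢ≢0 = >-nonZero (m<n⇒0<n (p>1 Fin.zero))

prime∣primePart⇒∣product : Prime r → (p z : Vec ℕ q) → r ∣ primePart p z → r ∣ product (toList p)
prime∣primePart⇒∣product r-prime []       []       r∣1 = ⊥-elim (prime∤1 r-prime r∣1)
prime∣primePart⇒∣product r-prime (pᵢ ∷ p) (zᵢ ∷ z) r∣∏ with euclidsLemma (pᵢ ^ zᵢ) (primePart p z) r-prime r∣∏
... | inj₁ r∣pᵢ^zᵢ = ∣m⇒∣m*n (product (toList p)) (prime∣^⇒∣ {k = zᵢ} r-prime r∣pᵢ^zᵢ)
... | inj₂ r∣∏′    = ∣n⇒∣m*n pᵢ (prime∣primePart⇒∣product r-prime p z r∣∏′)

maximum : Vec ℕ l → ℕ
maximum []      = 0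
maximum (x ∷ v) = x ⊔ maximum v

lookup≤maximum : (v : Vec ℕ l) → ∀ j → lookup v j ≤ maximum v
lookup≤maximum (x ∷ v) Fin.zero    = m≤m⊔n x (maximum v)
lookup≤maximum (x ∷ v) (Fin.suc j) = ≤-trans (lookup≤maximum v j) (m≤n⊔m x (maximum v))

maximum!≤factPart : (A n : Vec ℕ l) → (∀ j → 0 < lookup A j) → maximum n ! ≤ factPart A n
maximum!≤factPart []       []       _   = ≤-refl
maximum!≤factPart (a ∷ A) (k ∷ n) A>0 = begin
  (k ⊔ maximum n) !           ≤⟨ [m⊔n]!≤m!*n! k (maximum n) ⟩
  k ! * maximum n !           ≤⟨ *-mono-≤ (m≤m*n (k !) (a ^ k) {{m^n≢0 a k {{>-nonZero (A>0 Fin.zero)}}}})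
                                          (maximum!≤factPart A n (A>0 ∘ Fin.suc)) ⟩
  k ! * a ^ k * factPart A n  ∎
  where open ≤-Reasoning

prime∣factPart : Prime r → (A n : Vec ℕ l) → r ∣ factPart A n → r ∣ product (toList A) ⊎ r ≤ maximum n
prime∣factPart r-prime []      []      r∣1 = ⊥-elim (prime∤1 r-prime r∣1)
prime∣factPart r-prime (a ∷ A) (k ∷ n) r∣∏ with euclidsLemma (k ! * a ^ k) (factPart A n) r-prime r∣∏
... | inj₂ r∣∏′ = Sum.map (∣n⇒∣m*n a) (λ r≤max → ≤-trans r≤max (m≤n⊔m k (maximum n)))
                          (prime∣factPart r-prime A n r∣∏′)
... | inj₁ r∣k!*a^k with euclidsLemma (k !) (a ^ k) r-prime r∣k!*a^k
...   | inj₁ r∣k!  = inj₂ (≤-trans (prime∣n!⇒≤ r-prime r∣k!) (m≤m⊔n k (maximum n)))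
...   | inj₂ r∣a^k = inj₁ (∣m⇒∣m*n (product (toList A)) (prime∣^⇒∣ {k = k} r-prime r∣a^k))

-- Szpiro's inequality for f

coprime-*ʳ : Coprime m n → Coprime m k → Coprime m (n * k)
coprime-*ʳ m⊥n m⊥k {d} (d∣m , d∣n*k) = m⊥k (d∣m , coprime-divisor d⊥n d∣n*k)
  where
  d⊥n : Coprime d _
  d⊥n (c∣d , c∣n) = m⊥n (∣-trans c∣d d∣m , c∣n)

coprime-^ʳ : ∀ k → Coprime m n → Coprime m (n ^ k)
coprime-^ʳ zero    _   (_ , d∣1) = ∣1⇒≡1 d∣1
coprime-^ʳ (suc k) m⊥n = coprime-*ʳ m⊥n (coprime-^ʳ k m⊥n)

coprime-^ : ∀ k → Coprime m n → Coprime (m ^ k) (n ^ k)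
coprime-^ k m⊥n = Coprime.sym (coprime-^ʳ k (Coprime.sym (coprime-^ʳ k m⊥n)))

∣i^n∣≡∣i∣^n : ∀ i n → ℤ.∣ i ℤ.^ n ∣ ≡ ℤ.∣ i ∣ ^ n
∣i^n∣≡∣i∣^n i zero    = refl
∣i^n∣≡∣i∣^n i (suc n) = trans (ℤ.abs-* i (i ℤ.^ n)) (cong (ℤ.∣ i ∣ *_) (∣i^n∣≡∣i∣^n i n))

coprime-+ʳ : Coprime ℤ.∣ i ∣ ℤ.∣ j ∣ → Coprime ℤ.∣ i ∣ ℤ.∣ i ℤ.+ j ∣
coprime-+ʳ {i} {j} i⊥j {d} (d∣i , d∣i+j) =
  i⊥j (d∣i , ∣⇒∣ᵤ (ℤ∣.∣m+n∣m⇒∣n {+ d} {i} {j} (∣ᵤ⇒∣ d∣i+j) (∣ᵤ⇒∣ d∣i)))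

coprime-sum : Coprime ℤ.∣ i ∣ ℤ.∣ j ∣ → Coprime ℤ.∣ i ∣ ℤ.∣ i ℤ.+ j ∣ × Coprime ℤ.∣ j ∣ ℤ.∣ i ℤ.+ j ∣
coprime-sum {i} {j} i⊥j =
  coprime-+ʳ {i} {j} i⊥j , subst (λ k → Coprime ℤ.∣ j ∣ ℤ.∣ k ∣) (ℤ.+-comm j i) (coprime-+ʳ {j} {i} (Coprime.sym i⊥j))

szpiro-sum : WeakSzpiro → ∃[ e ] ∀ i j → Coprime ℤ.∣ i ∣ ℤ.∣ j ∣ → ¬ i ℤ.* j ℤ.* (i ℤ.+ j) ≡ + 0 →
             ℤ.∣ i ℤ.* j ℤ.* (i ℤ.+ j) ∣ < radℕ ℤ.∣ i ℤ.* j ℤ.* (i ℤ.+ j) ∣ ^ e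
szpiro-sum (e , _ , szpiro) = e , λ i j i⊥j abc≢0 →
  let i⊥i+j , j⊥i+j = coprime-sum {i} {j} i⊥j in szpiro i j (i ℤ.+ j) i⊥j i⊥i+j j⊥i+j refl abc≢0

signed : Sign → ℤ → ℤ
signed Sign.+ i = i
signed Sign.- i = ℤ.- i

∣signed∣ : ∀ σ i → ℤ.∣ signed σ i ∣ ≡ ℤ.∣ i ∣
∣signed∣ Sign.+ i = refl
∣signed∣ Sign.- i = ℤ.∣-i∣≡∣i∣ i

abc : Sign → ℕ → ℤ → ℤ → ℤ
abc σ s x y = X ℤ.* Y ℤ.* (X ℤ.+ Y)
  where
  X = x ℤ.^ s
  Y = signed σ (y ℤ.^ s)

i^[2*n]≡i^n*i^n : ∀ i n → i ℤ.^ (2 * n) ≡ i ℤ.^ n ℤ.* i ℤ.^ n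
i^[2*n]≡i^n*i^n i n = trans (cong (λ k → i ℤ.^ (n + k)) (+-identityʳ n)) (ℤ.^-distribˡ-+-* i n n)

f≡±abc : ∀ σ s x y → f σ s x y ≡ signed σ (abc σ s x y)
f≡±abc Sign.+ s x y = trans (cong₂ (λ u v → u ℤ.* y ℤ.^ s ℤ.+ v ℤ.* x ℤ.^ s) (i^[2*n]≡i^n*i^n x s) (i^[2*n]≡i^n*i^n y s))
                            (factorise (x ℤ.^ s) (y ℤ.^ s))
  where
  factorise : ∀ X Y → X ℤ.* X ℤ.* Y ℤ.+ Y ℤ.* Y ℤ.* X ≡ X ℤ.* Y ℤ.* (X ℤ.+ Y)
  factorise = ℤ-Solver.solve-∀
f≡±abc Sign.- s x y = trans (cong₂ (λ u v → u ℤ.* y ℤ.^ s ℤ.- v ℤ.* x ℤ.^ s) (i^[2*n]≡i^n*i^n x s) (i^[2*n]≡i^n*i^n y s))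
                            (factorise (x ℤ.^ s) (y ℤ.^ s))
  where
  factorise : ∀ X Y → X ℤ.* X ℤ.* Y ℤ.- Y ℤ.* Y ℤ.* X ≡ ℤ.- (X ℤ.* ℤ.- Y ℤ.* (X ℤ.+ ℤ.- Y))
  factorise = ℤ-Solver.solve-∀

∣f∣≡∣abc∣ : ∀ σ s x y → ℤ.∣ f σ s x y ∣ ≡ ℤ.∣ abc σ s x y ∣
∣f∣≡∣abc∣ σ s x y = trans (cong ℤ.∣_∣ (f≡±abc σ s x y)) (∣signed∣ σ (abc σ s x y))

szpiro-f : WeakSzpiro → ∃[ e ] ∀ σ s x y → gcd x y ≡ + 1 → ¬ f σ s x y ≡ + 0 →
           ℤ.∣ f σ s x y ∣ < radℕ ℤ.∣ f σ s x y ∣ ^ e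
szpiro-f weakSzpiro with szpiro-sum weakSzpiro
... | e , szpiro = e , λ σ s x y gcd≡1 f≢0 →
  subst (λ m → m < radℕ m ^ e) (sym (∣f∣≡∣abc∣ σ s x y))
    (szpiro (x ℤ.^ s) (signed σ (y ℤ.^ s)) (x^s⊥y^s σ s gcd≡1)
      λ abc≡0 → f≢0 (ℤ.∣i∣≡0⇒i≡0 (trans (∣f∣≡∣abc∣ σ s x y) (cong ℤ.∣_∣ abc≡0))))
  where
  x^s⊥y^s : ∀ {x y} σ s → gcd x y ≡ + 1 → Coprime ℤ.∣ x ℤ.^ s ∣ ℤ.∣ signed σ (y ℤ.^ s) ∣
  x^s⊥y^s {x} {y} σ s gcd≡1 =
    subst₂ Coprime (sym (∣i^n∣≡∣i∣^n x s)) (sym (trans (∣signed∣ σ (y ℤ.^ s)) (∣i^n∣≡∣i∣^n y s)))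
      (coprime-^ s (gcd≡1⇒coprime (ℤ.+-injective gcd≡1)))

factors≤product : ∀ u v w .{{_ : NonZero (u * v * w)}} → u ≤ u * v * w × v ≤ u * v * w
factors≤product u v w = ≤-trans (m≤m*n u v {{v≢0}}) uv≤uvw , ≤-trans (m≤n*m v u {{u≢0}}) uv≤uvw
  where
  uv≢0 = m*n≢0⇒m≢0 (u * v)
  u≢0 = m*n≢0⇒m≢0 u {{uv≢0}}
  v≢0 = m*n≢0⇒n≢0 u {{uv≢0}}
  uv≤uvw = m≤m*n (u * v) w {{m*n≢0⇒n≢0 (u * v)}}

∣i∣≤∣i^n∣ : ∀ i n .{{_ : NonZero n}} → ℤ.∣ i ∣ ≤ ℤ.∣ i ℤ.^ n ∣
∣i∣≤∣i^n∣ i n = subst (ℤ.∣ i ∣ ≤_) (sym (∣i^n∣≡∣i∣^n i n)) (m≤m^n ℤ.∣ i ∣ n)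

∣x∣,∣y∣≤∣f∣ : ∀ σ s x y .{{_ : NonZero s}} → ¬ f σ s x y ≡ + 0 →
             ℤ.∣ x ∣ ≤ ℤ.∣ f σ s x y ∣ × ℤ.∣ y ∣ ≤ ℤ.∣ f σ s x y ∣
∣x∣,∣y∣≤∣f∣ σ s x y f≢0 = subst (λ m → ℤ.∣ x ∣ ≤ m × ℤ.∣ y ∣ ≤ m) (sym ∣f∣≡)
  (≤-trans (∣i∣≤∣i^n∣ x s) (proj₁ factors≤) , ≤-trans ∣y∣≤∣Y∣ (proj₂ factors≤))
  where
  X = x ℤ.^ s
  Y = signed σ (y ℤ.^ s)
  ∣f∣≡ : ℤ.∣ f σ s x y ∣ ≡ ℤ.∣ X ∣ * ℤ.∣ Y ∣ * ℤ.∣ X ℤ.+ Y ∣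
  ∣f∣≡ = trans (∣f∣≡∣abc∣ σ s x y) (trans (ℤ.abs-* (X ℤ.* Y) (X ℤ.+ Y)) (cong (_* ℤ.∣ X ℤ.+ Y ∣) (ℤ.abs-* X Y)))
  factors≤ = factors≤product ℤ.∣ X ∣ ℤ.∣ Y ∣ ℤ.∣ X ℤ.+ Y ∣ {{≢-nonZero λ ∣f∣≡0 → f≢0 (ℤ.∣i∣≡0⇒i≡0 (trans ∣f∣≡ ∣f∣≡0))}}
  ∣y∣≤∣Y∣ : ℤ.∣ y ∣ ≤ ℤ.∣ Y ∣
  ∣y∣≤∣Y∣ = subst (ℤ.∣ y ∣ ≤_) (sym (∣signed∣ σ (y ℤ.^ s))) (∣i∣≤∣i^n∣ y s)

boundedVecs : ∀ q → ℕ → List (Vec ℕ q)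
boundedVecs zero    B = List.[ [] ]
boundedVecs (suc q) B = cartesianProductWith _∷_ (upTo B) (boundedVecs q B)

∈-boundedVecs : ∀ B (v : Vec ℕ q) → (∀ i → lookup v i < B) → v ∈ boundedVecs q B
∈-boundedVecs B []      _   = here refl
∈-boundedVecs B (x ∷ v) v<B =
  ∈-cartesianProductWith⁺ _∷_ (∈-upTo⁺ (v<B Fin.zero)) (∈-boundedVecs B v (v<B ∘ Fin.suc))

boundedInts : ℕ → List ℤ
boundedInts B = List.map +_ (upTo B) ++ List.map -[1+_] (upTo B)

∈-boundedInts : ∀ B x → ℤ.∣ x ∣ < B → x ∈ boundedInts B
∈-boundedInts B (+ k)    k<B  = ∈-++⁺ˡ (∈-map⁺ +_ (∈-upTo⁺ k<B))
∈-boundedInts B -[1+ k ] 1+k<B = ∈-++⁺ʳ (List.map +_ (upTo B)) (∈-map⁺ -[1+_] (∈-upTo⁺ (<⇒≤ 1+k<B)))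

box : ∀ q l → ℕ → List (Vec ℕ q × Vec ℕ l × ℤ × ℤ)
box q l B = cartesianProduct (boundedVecs q B) (cartesianProduct (boundedVecs l B)
              (cartesianProduct (boundedInts B) (boundedInts B)))

∈-box : ∀ B (z : Vec ℕ q) (n : Vec ℕ l) x y → (∀ i → lookup z i < B) → (∀ j → lookup n j < B) →
        ℤ.∣ x ∣ < B → ℤ.∣ y ∣ < B → (z , n , x , y) ∈ box q l B
∈-box B z n x y z<B n<B x<B y<B =
  ∈-cartesianProduct⁺ (∈-boundedVecs B z z<B) (∈-cartesianProduct⁺ (∈-boundedVecs B n n<B)
    (∈-cartesianProduct⁺ (∈-boundedInts B x x<B) (∈-boundedInts B y y<B)))

module Solutions (σ : Sign) (s : ℕ) (s>0 : 0 < s) (b : ℤ) (b≢0 : ¬ b ≡ + 0) {q l} (p : Vec ℕ q) (A : Vec ℕ l)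
                 (p>1 : ∀ i → 1 < lookup p i) (A>0 : ∀ j → 0 < lookup A j) where

  IsSolution : Vec ℕ q → Vec ℕ l → ℤ → ℤ → Set
  IsSolution z n x y = b ℤ.* + (primePart p z * factPart A n) ≡ f σ s x y

  lhs : Vec ℕ q → Vec ℕ l → ℕ
  lhs z n = ℤ.∣ b ∣ * (primePart p z * factPart A n)

  coefficient : ℕ
  coefficient = ℤ.∣ b ∣ * product (toList p) * product (toList A)

  private
    ∣b∣>0 : 0 < ℤ.∣ b ∣
    ∣b∣>0 = n≢0⇒n>0 (b≢0 ∘ ℤ.∣i∣≡0⇒i≡0)

    instance
      ∣b∣≢0 : NonZero ℤ.∣ b ∣
      ∣b∣≢0 = >-nonZero ∣b∣>0

      s≢0 : NonZero s
      s≢0 = >-nonZero s>0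

    p>0 : ∀ i → 0 < lookup p i
    p>0 = m<n⇒0<n ∘ p>1

    factPart>0 : ∀ n → 0 < factPart A n
    factPart>0 n = ≤-trans (1≤n! (maximum n)) (maximum!≤factPart A n A>0)

  ∣f∣≡lhs : ∀ {z n x y} → IsSolution z n x y → ℤ.∣ f σ s x y ∣ ≡ lhs z n
  ∣f∣≡lhs sol = trans (cong ℤ.∣_∣ (sym sol)) (ℤ.abs-* b _)

  lhs>0 : ∀ z n → 0 < lhs z n
  lhs>0 z n = *-mono-≤ ∣b∣>0 (*-mono-≤ (primePart>0 p z p>0) (factPart>0 n))

  f≢0 : ∀ {z n x y} → IsSolution z n x y → ¬ f σ s x y ≡ + 0
  f≢0 {z} {n} sol f≡0 = <-irrefl (trans (cong ℤ.∣_∣ (sym f≡0)) (∣f∣≡lhs sol)) (lhs>0 z n)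

  prime∣lhs : ∀ z n → Prime r → r ∣ lhs z n → r ∣ coefficient * primorial (suc (maximum n))
  prime∣lhs z n r-prime r∣lhs with euclidsLemma ℤ.∣ b ∣ _ r-prime r∣lhs
  ... | inj₁ r∣b = ∣m⇒∣m*n _ (∣m⇒∣m*n (product (toList A)) (∣m⇒∣m*n (product (toList p)) r∣b))
  ... | inj₂ r∣P*F with euclidsLemma (primePart p z) (factPart A n) r-prime r∣P*F
  ...   | inj₁ r∣P = ∣m⇒∣m*n _ (∣m⇒∣m*n (product (toList A))
                       (∣n⇒∣m*n ℤ.∣ b ∣ (prime∣primePart⇒∣product r-prime p z r∣P)))
  ...   | inj₂ r∣F with prime∣factPart r-prime A n r∣F
  ...     | inj₁ r∣∏A  = ∣m⇒∣m*n _ (∣n⇒∣m*n (ℤ.∣ b ∣ * product (toList p)) r∣∏A)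
  ...     | inj₂ r≤max = ∣n⇒∣m*n coefficient (prime∣primorial r-prime (s≤s r≤max))

  radℕ-lhs≤ : ∀ z n → radℕ (lhs z n) ≤ coefficient * 8 * 8 ^ maximum n
  radℕ-lhs≤ z n = begin
    radℕ (lhs z n)                             ≤⟨ ∣⇒≤ {{>-nonZero c*π>0}} (radℕ-∣ (λ _ → prime∣lhs z n)) ⟩
    coefficient * primorial (suc (maximum n))  ≤⟨ *-monoʳ-≤ coefficient (primorial≤8^n (suc (maximum n))) ⟩
    coefficient * (8 * 8 ^ maximum n)          ≡⟨ *-assoc coefficient 8 (8 ^ maximum n) ⟨
    coefficient * 8 * 8 ^ maximum n            ∎
    where
    open ≤-Reasoning
    c*π>0 = *-mono-≤ (*-mono-≤ (*-mono-≤ ∣b∣>0 (product>0 p p>0)) (product>0 A A>0)) (primorial>0 (suc (maximum n)))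

  maximum!≤lhs : ∀ z n → maximum n ! ≤ lhs z n
  maximum!≤lhs z n = ≤-trans (maximum!≤factPart A n A>0)
    (≤-trans (m≤n*m _ _ {{>-nonZero (primePart>0 p z p>0)}}) (m≤n*m _ ℤ.∣ b ∣))

  lookup≤lhs : ∀ z n → (∀ i → lookup z i ≤ lhs z n) × (∀ j → lookup n j ≤ lhs z n)
  lookup≤lhs z n = (λ i → ≤-trans (lookup≤primePart p z p>1 i) P≤lhs)
                 , (λ j → ≤-trans (lookup≤maximum n j) (≤-trans (n≤n! (maximum n)) (maximum!≤lhs z n)))
    where
    P≤lhs : primePart p z ≤ lhs z n
    P≤lhs = ≤-trans (m≤m*n _ _ {{>-nonZero (factPart>0 n)}}) (m≤n*m _ ℤ.∣ b ∣)

  coordinates≤∣f∣ : ∀ {z n x y} → IsSolution z n x y →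
                    ((∀ i → lookup z i ≤ ℤ.∣ f σ s x y ∣) × (∀ j → lookup n j ≤ ℤ.∣ f σ s x y ∣)) ×
                    (ℤ.∣ x ∣ ≤ ℤ.∣ f σ s x y ∣ × ℤ.∣ y ∣ ≤ ℤ.∣ f σ s x y ∣)
  coordinates≤∣f∣ {z} {n} {x} {y} sol =
      subst (λ m → (∀ i → lookup z i ≤ m) × (∀ j → lookup n j ≤ m)) (sym (∣f∣≡lhs sol)) (lookup≤lhs z n)
    , ∣x∣,∣y∣≤∣f∣ σ s x y (f≢0 sol)

  ∣f∣-bounded : WeakSzpiro → ∃[ B ] ∀ z n x y → gcd x y ≡ + 1 → IsSolution z n x y → ℤ.∣ f σ s x y ∣ < B
  ∣f∣-bounded weakSzpiro with szpiro-f weakSzpiro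
  ... | e , szpiro with factorial-bounded (coefficient * 8) 8 e
  ... | B , bounded = B , λ z n x y gcd≡1 sol → bounded (maximum n) _
    (subst (maximum n ! ≤_) (sym (∣f∣≡lhs sol)) (maximum!≤lhs z n))
    (<-≤-trans (szpiro σ s x y gcd≡1 (f≢0 sol))
               (^-monoˡ-≤ e (subst (λ m → radℕ m ≤ _) (sym (∣f∣≡lhs sol)) (radℕ-lhs≤ z n))))

  solutions⊆box : WeakSzpiro →
                  ∃[ B ] ∀ z n x y → gcd x y ≡ + 1 → IsSolution z n x y → (z , n , x , y) ∈ box q l B
  solutions⊆box weakSzpiro with ∣f∣-bounded weakSzpiro
  ... | B , ∣f∣<B = B , λ z n x y gcd≡1 sol →
    let (z≤ , n≤) , (x≤ , y≤) = coordinates≤∣f∣ sol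
        f<B = ∣f∣<B z n x y gcd≡1 sol
    in ∈-box B z n x y (λ i → ≤-<-trans (z≤ i) f<B) (λ j → ≤-<-trans (n≤ j) f<B) (≤-<-trans x≤ f<B) (≤-<-trans y≤ f<B)

theorem1p12 : WeakSzpiro →
    (σ : Sign) (s : ℕ) → 0 < s →
    (q : ℕ) (p : Vec ℕ q) → (∀ i → Prime (lookup p i)) →
    (∀ (i j : Fin q) → i Fin.< j → lookup p i < lookup p j) →
    (b : ℤ) → ¬ (b ≡ + 0) →
    (l : ℕ) → 1 ≤ l → (A : Vec ℕ l) → (∀ j → 1 ≤ lookup A j) →
    ∃ λ (sols : List (Vec ℕ q × Vec ℕ l × ℤ × ℤ)) →
      ∀ (z : Vec ℕ q) (n : Vec ℕ l) (x y : ℤ) →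
        (∀ j → 1 ≤ lookup n j) →
        gcd x y ≡ + 1 →
        b ℤ.* + (primePart p z * factPart A n) ≡ f σ s x y →
        (z , n , x , y) ∈ sols
theorem1p12 weakSzpiro σ s s>0 q p p-prime _ b b≢0 l _ A A>0 =
  let B , solutions∈box = Solutions.solutions⊆box σ s s>0 b b≢0 p A p>1 A>0 weakSzpiro
  in box q l B , λ z n x y _ → solutions∈box z n x y
  where
  p>1 : ∀ i → 1 < lookup p i
  p>1 i = nonTrivial⇒n>1 _ {{prime⇒nonTrivial (p-prime i)}}
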